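{- Let $\Gamma=(V,E)$ be a finite connected bipartite graph with vertex bipartition $V=\mathcal{E}\cup\mathcal{O}$ and $v_0\in\mathcal{E}$. If $f$ is a centered legal labeling of $\mathcal{E}$ and $K\subseteq\mathcal{E}$ is a maximum component of $f$, then $m_K(f)$ is also a centered legal labeling, and $P(m_K(f))=2^{|N(K)|-|B(K)|}P(f)$.
   Context: $N(v)$, $N(A)$ denote neighborhoods; $N^2(A)=N(N(A))$. A legal labeling of $\mathcal{E}$ is a map $f:\mathcal{E}\to\mathbb{Z}$ with $|f(u)-f(v)|\le1$ whenever $u,v\in\mathcal{E}$ are at graph distance $2$; it is centered if $f(v_0)=0$. For $A\subseteq\mathcal{E}$, $B(A)=\{v\in\mathcal{O}:N(v)\subseteq A\}$. The weight is $P(f)=\prod_{i\in\mathrm{im}(f)}2^{|B(f^{ -1}(i))|}$. A set $K\subseteq\mathcal{E}$ is $2$-linked if any two vertices of $K$ are joined by a sequence of vertices of $K$ with consecutive graph distances at most $2$. $K$ is a maximum component of $f$ if $K$ is $2$-linked and $f(y)<f(x)$ for all $x\in K$, $y\in N^2(K)\setminus K$. The merge $m_K(f):\mathcal{E}\to\mathbb{Z}$ is: if $v_0\notin K$, $m_K(f)=f-1$ on $K$ and $=f$ off $K$; if $v_0\in K$, $m_K(f)=f$ on $K$ and $=f+1$ off $K$. -}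

module Defs where

import Data.Nat
open import Data.Nat using (ℕ; zero; suc; _^_)
open import Data.Integer as ℤ using (ℤ; _-_; _+_)
open import Data.Fin using (Fin; zero; suc)
open import Data.Fin.Subset using (Subset; _∈_; _∉_; ∣_∣)
open import Data.Fin.Subset.Properties using (_∈?_)
open import Data.Bool using (Bool; true; false; _∧_; _∨_; not; if_then_else_; T)
open import Data.Vec using (tabulate)
open import Data.List using (List; map; deduplicate)
open import Data.Nat.ListAction using (product)
open import Data.List using () renaming (allFin to finList)
open import Data.Sum using (_⊎_; inj₁; inj₂)
open import Data.Product using (Σ; _×_; ∃)
open import Relation.Nullary using (¬_; does)
open import Relation.Binary.PropositionalEquality using (_≡_; _≢_)

anyFin : ∀ {n} → (Fin n → Bool) → Bool
anyFin {zero} p = false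
anyFin {suc n} p = p zero ∨ anyFin (λ i → p (suc i))

allFinB : ∀ {n} → (Fin n → Bool) → Bool
allFinB {zero} p = true
allFinB {suc n} p = p zero ∧ allFinB (λ i → p (suc i))

-- A finite bipartite graph with parts 𝓔 = Fin a and 𝓞 = Fin b,
-- given by its (decidable) adjacency relation between the parts.
Graph : ℕ → ℕ → Set
Graph a b = Fin a → Fin b → Bool

module _ {a b : ℕ} (G : Graph a b) where

  Adj : Fin a → Fin b → Set
  Adj e o = T (G e o)

  V : Set
  V = Fin a ⊎ Fin b

  data Edge : V → V → Set where
    eo : ∀ {e o} → Adj e o → Edge (inj₁ e) (inj₂ o)
    oe : ∀ {e o} → Adj e o → Edge (inj₂ o) (inj₁ e)

  data Reach : V → V → Set where
    here : ∀ {x} → Reach x x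
    step : ∀ {x y z} → Reach x y → Edge y z → Reach x z

  Connected : Set
  Connected = ∀ x y → Reach x y

  Dist2 : Fin a → Fin a → Set
  Dist2 u v = u ≢ v × ∃ λ o → Adj u o × Adj v o

  Legal : (Fin a → ℤ) → Set
  Legal f = ∀ u v → Dist2 u v → ℤ.∣ f u - f v ∣ Data.Nat.≤ 1

  Centered : Fin a → (Fin a → ℤ) → Set
  Centered v₀ f = f v₀ ≡ ℤ.0ℤ

  N : Subset a → Subset b
  N A = tabulate λ o → anyFin λ e → does (e ∈? A) ∧ G e o

  Nᵒ : Subset b → Subset a
  Nᵒ X = tabulate λ e → anyFin λ o → does (o ∈? X) ∧ G e o

  N² : Subset a → Subset a
  N² A = Nᵒ (N A)

  B : Subset a → Subset b
  B A = tabulate λ o → allFinB λ e → not (G e o) ∨ does (e ∈? A)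

  data Chain (K : Subset a) (u : Fin a) : Fin a → Set where
    start : u ∈ K → Chain K u u
    next  : ∀ {w w'} → Chain K u w → w' ∈ K → Dist2 w w' → Chain K u w'

  TwoLinked : Subset a → Set
  TwoLinked K = ∀ u v → u ∈ K → v ∈ K → Chain K u v

  MaxComponent : (Fin a → ℤ) → Subset a → Set
  MaxComponent f K = TwoLinked K ×
    (∀ x y → x ∈ K → y ∈ N² K → y ∉ K → f y ℤ.< f x)

  merge : Fin a → Subset a → (Fin a → ℤ) → Fin a → ℤ
  merge v₀ K f v =
    if does (v₀ ∈? K)
      then (if does (v ∈? K) then f v else f v + ℤ.1ℤ)
      else (if does (v ∈? K) then f v - ℤ.1ℤ else f v)

  preimage : (Fin a → ℤ) → ℤ → Subset a
  preimage f i = tabulate λ v → does (f v ℤ.≟ i)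

  image : (Fin a → ℤ) → List ℤ
  image f = deduplicate ℤ._≟_ (map f (finList a))

  P : (Fin a → ℤ) → ℕ
  P f = product (map (λ i → 2 ^ ∣ B (preimage f i) ∣) (image f))

-- The merge shifts f by a constant δ on K and by δ + 1 off K. Across the
-- boundary of K, maximality and legality force f to drop by exactly one, so
-- the merge equalises the labels around every odd vertex of N(K) ∖ B(K) and
-- shifts them by a constant around every other odd vertex; legality of the
-- merge follows in the same way. Since every odd vertex has a neighbour, it
-- lies in B(h⁻¹ i) for at most one label i, so P h = 2 ^ (number of odd
-- vertices whose neighbours all carry the same label), and the merge creates
-- exactly the |N(K)| − |B(K)| new such vertices of N(K) ∖ B(K).

module Submission where

open import Defs
open import Data.Nat using (ℕ; _*_; _^_; _∸_)
open import Data.Integer using (ℤ)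
open import Data.Fin using (Fin)
open import Data.Fin.Subset using (Subset; ∣_∣)
open import Data.Product using (_×_)
open import Relation.Binary.PropositionalEquality using (_≡_)

open import Level using (Level)
open import Function.Base using (_∘_; const)
open import Function.Bundles using (_⇔_; mk⇔; Equivalence; Inverse)
open import Data.Unit using (tt)
open import Data.Bool using (Bool; true; false; T; if_then_else_)
open import Data.Bool.Properties using (T-≡; T-∧; T-∨)
import Data.Nat as ℕ
import Data.Nat.Properties as ℕ
open import Data.Nat.ListAction using (sum; product)
open import Algebra.Properties.CommutativeMonoid.Sum ℕ.+-0-commutativeMonoid
  using (sum-syntax; ∑-distrib-+; sum-cong-≗; sum-replicate-zero)
import Data.Integer as ℤ
open import Data.Integer using (0ℤ; 1ℤ; -1ℤ; _+_; _-_; _<_)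
import Data.Integer.Properties as ℤ
open import Data.Integer.Tactic.RingSolver using (solve-∀)
open import Algebra.Properties.AbelianGroup ℤ.+-0-abelianGroup using (∙-cancelʳ)
open import Data.Fin using (zero; suc)
open import Data.Fin.Properties using (¬∀⟶∃¬)
open import Data.Fin.Subset using (_∈_; _∉_; _⊆_; _─_; inside; outside)
open import Data.Fin.Subset.Properties using (_∈?_; x∈p∧x∉q⇒x∈p─q; p─q⊆p; drop-∷-⊆)
open import Data.Vec using ([]; _∷_; tabulate; here; there)
open import Data.Vec.Properties using ([]=↔lookup; lookup∘tabulate)
open import Data.List using (List; []; _∷_; map)
open import Data.List.Relation.Unary.All as All using (All; []; _∷_)
open import Data.List.Relation.Unary.Any using (here; there)
open import Data.List.Relation.Unary.Unique.Propositional using (Unique)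
open import Data.List.Relation.Unary.AllPairs using (_∷_)
open import Data.List.Relation.Unary.Unique.DecPropositional.Properties ℤ._≟_ using (deduplicate-!)
open import Data.List.Membership.Propositional using () renaming (_∈_ to _∈ₗ_)
open import Data.List.Membership.Propositional.Properties using (∈-map⁺; ∈-allFin; ∈-deduplicate⁺)
open import Data.List.Properties using (map-cong)
open import Data.Sum using (inj₁; inj₂)
open import Data.Product using (∃-syntax; _,_; proj₁; proj₂)
open import Relation.Nullary using (¬_; Dec; yes; no; does; contradiction)
open import Relation.Nullary.Decidable using (dec-false; decidable-stable; T?; _×-dec_; _→-dec_)
import Relation.Nullary.Decidable as Dec
open import Relation.Unary using (Pred; Decidable)
open import Relation.Binary.PropositionalEquality
  using (refl; sym; trans; cong; cong₂; subst; _≢_; module ≡-Reasoning)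

open Equivalence using (to; from)

private
  variable
    ℓ : Level
    n : ℕ
    A : Set ℓ

T-does : (a? : Dec A) → T (does a?) ⇔ A
T-does (yes a) = mk⇔ (const a) (const tt)
T-does (no ¬a) = mk⇔ (λ ()) ¬a

T-anyFin : (p : Fin n → Bool) → T (anyFin p) ⇔ (∃[ i ] T (p i))
T-anyFin {n = ℕ.zero}  p = mk⇔ (λ ()) (λ ())
T-anyFin {n = ℕ.suc n} p = mk⇔ to′ from′
  where
  to′ : T (anyFin p) → ∃[ i ] T (p i)
  to′ t with T-∨ .to t
  ... | inj₁ p₀ = zero , p₀
  ... | inj₂ ps = let i , pᵢ = T-anyFin (p ∘ suc) .to ps in suc i , pᵢ
  from′ : ∃[ i ] T (p i) → T (anyFin p)
  from′ (zero  , p₀) = T-∨ .from (inj₁ p₀)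
  from′ (suc i , pᵢ) = T-∨ .from (inj₂ (T-anyFin (p ∘ suc) .from (i , pᵢ)))

T-allFinB : (p : Fin n → Bool) → T (allFinB p) ⇔ (∀ i → T (p i))
T-allFinB {n = ℕ.zero}  p = mk⇔ (λ _ ()) (const tt)
T-allFinB {n = ℕ.suc n} p = mk⇔ to′ from′
  where
  to′ : T (allFinB p) → ∀ i → T (p i)
  to′ t zero    = proj₁ (T-∧ .to t)
  to′ t (suc i) = T-allFinB (p ∘ suc) .to (proj₂ (T-∧ .to t)) i
  from′ : (∀ i → T (p i)) → T (allFinB p)
  from′ ps = T-∧ .from (ps zero , T-allFinB (p ∘ suc) .from (ps ∘ suc))

indicator : Bool → ℕ
indicator true  = 1
indicator false = 0

module _ {ℓ₁ ℓ₂ ℓ₃} {D : Set ℓ₁} {X : Set ℓ₂} {Y : Set ℓ₃} where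

  indicator-split : (d? : Dec D) (x? : Dec X) (y? : Dec Y)
    → (¬ D → X ⇔ Y) → (D → Y × ¬ X)
    → indicator (does y?) ≡ indicator (does d?) ℕ.+ indicator (does x?)
  indicator-split (yes d) (yes x) _      _     differ = contradiction x (proj₂ (differ d))
  indicator-split (yes d) (no _)  (yes _) _    _      = refl
  indicator-split (yes d) (no _)  (no ¬y) _    differ = contradiction (proj₁ (differ d)) ¬y
  indicator-split (no ¬d) (yes _) (yes _) _    _      = refl
  indicator-split (no ¬d) (yes x) (no ¬y) same _      = contradiction (same ¬d .to x) ¬y
  indicator-split (no ¬d) (no ¬x) (yes y) same _      = contradiction (same ¬d .from y) ¬x
  indicator-split (no ¬d) (no _)  (no _)  _    _      = refl

count : {P : Pred (Fin n) ℓ} → Decidable P → ℕ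
count {n = n} P? = ∑[ i < n ] indicator (does (P? i))

∣p∣≡count∈ : (p : Subset n) → ∣ p ∣ ≡ count (_∈? p)
∣p∣≡count∈ []            = refl
∣p∣≡count∈ (inside  ∷ p) = cong ℕ.suc (∣p∣≡count∈ p)
∣p∣≡count∈ (outside ∷ p) = ∣p∣≡count∈ p

∈-tabulate : (p : Fin n → Bool) {i : Fin n} → i ∈ tabulate p ⇔ T (p i)
∈-tabulate p {i} = mk⇔
  (λ i∈ → T-≡ .from (trans (sym (lookup∘tabulate p i)) (Inverse.to []=↔lookup i∈)))
  (λ t → Inverse.from []=↔lookup (trans (lookup∘tabulate p i) (T-≡ .to t)))

module _ {m : ℕ} {R : Fin n → Fin m → Set ℓ} (R? : ∀ i j → Dec (R i j)) {i : Fin n} where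

  ∈-tabulate-any : i ∈ tabulate (λ i → anyFin λ j → does (R? i j)) ⇔ (∃[ j ] R i j)
  ∈-tabulate-any = mk⇔
    (λ i∈ → let j , t = T-anyFin _ .to (∈-tabulate _ .to i∈) in j , T-does (R? i j) .to t)
    (λ (j , r) → ∈-tabulate _ .from (T-anyFin _ .from (j , T-does (R? i j) .from r)))

  ∈-tabulate-all : i ∈ tabulate (λ i → allFinB λ j → does (R? i j)) ⇔ (∀ j → R i j)
  ∈-tabulate-all = mk⇔
    (λ i∈ j → T-does (R? i j) .to (T-allFinB _ .to (∈-tabulate _ .to i∈) j))
    (λ r → ∈-tabulate _ .from (T-allFinB _ .from λ j → T-does (R? i j) .from (r j)))

∈-tabulate-does : {P : Pred (Fin n) ℓ} (P? : Decidable P) {i : Fin n}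
  → i ∈ tabulate (does ∘ P?) ⇔ P i
∈-tabulate-does P? {i} =
  mk⇔ (T-does (P? i) .to ∘ ∈-tabulate _ .to) (∈-tabulate _ .from ∘ T-does (P? i) .from)

x∈p─q⇒x∉q : {p q : Subset n} {x : Fin n} → x ∈ p ─ q → x ∉ q
x∈p─q⇒x∉q {p = _ ∷ _} {q = _ ∷ _} (there x∈p─q) (there x∈q) = x∈p─q⇒x∉q x∈p─q x∈q
x∈p─q⇒x∉q {p = inside  ∷ _} {q = inside ∷ _} () here
x∈p─q⇒x∉q {p = outside ∷ _} {q = inside ∷ _} () here

∣p─q∣+∣q∣≡∣p∣ : {p q : Subset n} → q ⊆ p → ∣ p ─ q ∣ ℕ.+ ∣ q ∣ ≡ ∣ p ∣
∣p─q∣+∣q∣≡∣p∣ {p = []}          {[]}          _   = refl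
∣p─q∣+∣q∣≡∣p∣ {p = inside  ∷ p} {outside ∷ q} q⊆p = cong ℕ.suc (∣p─q∣+∣q∣≡∣p∣ (drop-∷-⊆ q⊆p))
∣p─q∣+∣q∣≡∣p∣ {p = outside ∷ p} {outside ∷ q} q⊆p = ∣p─q∣+∣q∣≡∣p∣ (drop-∷-⊆ q⊆p)
∣p─q∣+∣q∣≡∣p∣ {p = inside  ∷ p} {inside  ∷ q} q⊆p =
  trans (ℕ.+-suc ∣ p ─ q ∣ ∣ q ∣) (cong ℕ.suc (∣p─q∣+∣q∣≡∣p∣ (drop-∷-⊆ q⊆p)))
∣p─q∣+∣q∣≡∣p∣ {p = outside ∷ p} {inside  ∷ q} q⊆p = contradiction (q⊆p here) λ ()

∣p∣∸∣q∣≡∣p─q∣ : {p q : Subset n} → q ⊆ p → ∣ p ∣ ∸ ∣ q ∣ ≡ ∣ p ─ q ∣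
∣p∣∸∣q∣≡∣p─q∣ {p = p} {q} q⊆p =
  trans (cong (_∸ ∣ q ∣) (sym (∣p─q∣+∣q∣≡∣p∣ q⊆p))) (ℕ.m+n∸n≡m ∣ p ─ q ∣ ∣ q ∣)

product-map-^ : (m : ℕ) (F : A → ℕ) (xs : List A)
  → product (map (λ x → m ^ F x) xs) ≡ m ^ sum (map F xs)
product-map-^ m F []       = refl
product-map-^ m F (x ∷ xs) =
  trans (cong (m ^ F x *_) (product-map-^ m F xs)) (sym (ℕ.^-distribˡ-+-* m (F x) (sum (map F xs))))

sum-map-∑-comm : (F : A → Fin n → ℕ) (xs : List A)
  → sum (map (λ x → ∑[ i < n ] F x i) xs) ≡ ∑[ i < n ] sum (map (λ x → F x i) xs)
sum-map-∑-comm {n = n} F []       = sym (sum-replicate-zero n)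
sum-map-∑-comm         F (x ∷ xs) =
  trans (cong (_ ℕ.+_) (sum-map-∑-comm F xs)) (sym (∑-distrib-+ (F x) _))

sum-map-zero : {F : A → ℕ} {xs : List A} → All (λ x → F x ≡ 0) xs → sum (map F xs) ≡ 0
sum-map-zero []            = refl
sum-map-zero (Fx≡0 ∷ Fxs≡0) = cong₂ ℕ._+_ Fx≡0 (sum-map-zero Fxs≡0)

sum-map-concentrated : {F : A → ℕ} {c : A} {xs : List A}
  → Unique xs → c ∈ₗ xs → (∀ {x} → x ≢ c → F x ≡ 0) → sum (map F xs) ≡ F c
sum-map-concentrated {F = F} {c} (c≢xs ∷ _) (here refl) vanish =
  trans (cong (F c ℕ.+_) (sum-map-zero (All.map (λ c≢x → vanish (c≢x ∘ sym)) c≢xs)))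
        (ℕ.+-identityʳ (F c))
sum-map-concentrated (x≢xs ∷ xs-unique) (there c∈xs) vanish =
  cong₂ ℕ._+_ (vanish (All.lookup x≢xs c∈xs)) (sum-map-concentrated xs-unique c∈xs vanish)

j+[i-j]≡i : ∀ i j → j + (i - j) ≡ i
j+[i-j]≡i = solve-∀

[i+k]-[j+k]≡i-j : ∀ i j k → (i + k) - (j + k) ≡ i - j
[i+k]-[j+k]≡i-j = solve-∀

[i+1]+k≡i+[k+1] : ∀ i k → (i + 1ℤ) + k ≡ i + (k + 1ℤ)
[i+1]+k≡i+[k+1] = solve-∀

j<i∧∣j-i∣≤1⇒i≡j+1 : {i j : ℤ} → j < i → ℤ.∣ j - i ∣ ℕ.≤ 1 → i ≡ j + 1ℤ
j<i∧∣j-i∣≤1⇒i≡j+1 {i} {j} j<i ∣j-i∣≤1 = by-cases ℤ.∣ j - i ∣ ∣j-i∣≤1 (ℤ.∣-∣-≤ (ℤ.<⇒≤ j<i))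
  where
  i≡j+k : ∀ {k} → k ≡ i - j → i ≡ j + k
  i≡j+k k≡i-j = trans (sym (j+[i-j]≡i i j)) (cong (j +_) (sym k≡i-j))
  by-cases : ∀ k → k ℕ.≤ 1 → ℤ.+ k ≡ i - j → i ≡ j + 1ℤ
  by-cases 0 _ 0≡i-j = contradiction (sym (trans (i≡j+k 0≡i-j) (ℤ.+-identityʳ j))) (ℤ.<⇒≢ j<i)
  by-cases 1 _ 1≡i-j = i≡j+k 1≡i-j
  by-cases (ℕ.suc (ℕ.suc _)) (ℕ.s≤s ()) _

i≡j⇒∣i-j∣≤1 : {i j : ℤ} → i ≡ j → ℤ.∣ i - j ∣ ℕ.≤ 1
i≡j⇒∣i-j∣≤1 i≡j = subst (λ d → ℤ.∣ d ∣ ℕ.≤ 1) (sym (ℤ.i≡j⇒i-j≡0 i≡j)) ℕ.z≤n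

module _ {a b : ℕ} (G : Graph a b) where

  ∈preimage⇔ : (h : Fin a → ℤ) {i : ℤ} {e : Fin a} → e ∈ preimage G h i ⇔ (h e ≡ i)
  ∈preimage⇔ h {i} = ∈-tabulate-does (λ e → h e ℤ.≟ i)

  -- The Booleans tabulated in N and B are, definitionally, `does` of these decisions.
  ∈N⇔ : {A : Subset a} {o : Fin b} → o ∈ N G A ⇔ (∃[ e ] e ∈ A × Adj G e o)
  ∈N⇔ {A} = ∈-tabulate-any (λ o e → (e ∈? A) ×-dec T? (G e o))

  ∈B⇔ : {A : Subset a} {o : Fin b} → o ∈ B G A ⇔ (∀ e → Adj G e o → e ∈ A)
  ∈B⇔ {A} = ∈-tabulate-all (λ o e → T? (G e o) →-dec (e ∈? A))

  common-neighbour⇒∈N² : {A : Subset a} {e e' : Fin a} {o : Fin b}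
    → e ∈ A → Adj G e o → Adj G e' o → e' ∈ N² G A
  common-neighbour⇒∈N² {A} e∈A ae ae' =
    ∈-tabulate-any (λ e o → (o ∈? N G A) ×-dec T? (G e o)) .from
      (_ , ∈N⇔ .from (_ , e∈A , ae) , ae')

  ∉B⇒∃∉ : {A : Subset a} {o : Fin b} → o ∉ B G A → ∃[ e ] Adj G e o × e ∉ A
  ∉B⇒∃∉ {A} {o} o∉B =
    let e , ¬[ae⇒e∈A] = ¬∀⟶∃¬ a _ (λ e → T? (G e o) →-dec (e ∈? A)) (o∉B ∘ ∈B⇔ .from)
    in e , decidable-stable (T? (G e o)) (λ ¬ae → ¬[ae⇒e∈A] λ ae → contradiction ae ¬ae)
         , ¬[ae⇒e∈A] ∘ const

  neighbour-of-reachable : {v : Fin a} {o : Fin b} → Reach G (inj₁ v) (inj₂ o) → ∃[ e ] Adj G e o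
  neighbour-of-reachable (step _ (eo ae)) = _ , ae

  Monochromatic : (Fin a → ℤ) → Fin b → Set
  Monochromatic h o = ∀ {e e'} → Adj G e o → Adj G e' o → h e ≡ h e'

  Monochromatic-shift : {h h' : Fin a → ℤ} {o : Fin b} (δ : ℤ)
    → (∀ {e} → Adj G e o → h' e ≡ h e + δ) → Monochromatic h o ⇔ Monochromatic h' o
  Monochromatic-shift δ shift = mk⇔
    (λ mono {_} {_} ae ae' → trans (shift ae) (trans (cong (_+ δ) (mono ae ae')) (sym (shift ae'))))
    (λ mono {_} {_} ae ae' →
      ∙-cancelʳ δ _ _ (trans (sym (shift ae)) (trans (mono ae ae') (shift ae'))))

  ∈B-preimage⇒≡ : (h : Fin a → ℤ) {i : ℤ} {e : Fin a} {o : Fin b}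
    → Adj G e o → o ∈ B G (preimage G h i) → h e ≡ i
  ∈B-preimage⇒≡ h ae o∈B = ∈preimage⇔ h .to (∈B⇔ .to o∈B _ ae)

  ∈B-preimage⇔Monochromatic : (h : Fin a → ℤ) {c : Fin a} {o : Fin b}
    → Adj G c o → o ∈ B G (preimage G h (h c)) ⇔ Monochromatic h o
  ∈B-preimage⇔Monochromatic h ac = mk⇔
    (λ o∈B {_} {_} ae ae' → trans (∈B-preimage⇒≡ h ae o∈B) (sym (∈B-preimage⇒≡ h ae' o∈B)))
    (λ mono → ∈B⇔ .from λ e ae → ∈preimage⇔ h .from (mono ae ac))

  -- Connectedness enters only here: an odd vertex without neighbours would lie
  -- in B(h⁻¹ i) for every label i.
  module _ (neighbour : ∀ o → ∃[ e ] Adj G e o) where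

    B⊆N : {A : Subset a} → B G A ⊆ N G A
    B⊆N {A} {o} o∈B = let e , ae = neighbour o in ∈N⇔ .from (e , ∈B⇔ .to o∈B e ae , ae)

    monochromatic? : (h : Fin a → ℤ) → Decidable (Monochromatic h)
    monochromatic? h o = Dec.map (∈B-preimage⇔Monochromatic h (proj₂ (neighbour o)))
                                 (o ∈? B G (preimage G h (h (proj₁ (neighbour o)))))

    P≡2^count : (h : Fin a → ℤ) → P G h ≡ 2 ^ count (monochromatic? h)
    P≡2^count h = trans (product-map-^ 2 ∣B[h⁻¹]∣ (image G h)) (cong (2 ^_) ∑∣B[h⁻¹]∣≡count)
      where
      open ≡-Reasoning
      ∣B[h⁻¹]∣ : ℤ → ℕ
      ∣B[h⁻¹]∣ i = ∣ B G (preimage G h i) ∣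
      𝟙B[h⁻¹] : ℤ → Fin b → ℕ
      𝟙B[h⁻¹] i o = indicator (does (o ∈? B G (preimage G h i)))
      image∋ : ∀ e → h e ∈ₗ image G h
      image∋ e = ∈-deduplicate⁺ ℤ._≟_ (∈-map⁺ h (∈-allFin e))
      vanish : ∀ o {i} → i ≢ h (proj₁ (neighbour o)) → 𝟙B[h⁻¹] i o ≡ 0
      vanish o i≢ = cong indicator (dec-false (o ∈? _)
        λ o∈B → i≢ (sym (∈B-preimage⇒≡ h (proj₂ (neighbour o)) o∈B)))
      ∑∣B[h⁻¹]∣≡count : sum (map ∣B[h⁻¹]∣ (image G h)) ≡ count (monochromatic? h)
      ∑∣B[h⁻¹]∣≡count = begin
        sum (map ∣B[h⁻¹]∣ (image G h))
          ≡⟨ cong sum (map-cong (λ i → ∣p∣≡count∈ (B G (preimage G h i))) (image G h)) ⟩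
        sum (map (λ i → ∑[ o < b ] 𝟙B[h⁻¹] i o) (image G h))
          ≡⟨ sum-map-∑-comm 𝟙B[h⁻¹] (image G h) ⟩
        ∑[ o < b ] sum (map (λ i → 𝟙B[h⁻¹] i o) (image G h))
          ≡⟨ sum-cong-≗ (λ o → sum-map-concentrated (deduplicate-! _) (image∋ _) (vanish o)) ⟩
        count (monochromatic? h) ∎

  module Merge (v₀ : Fin a) (f : Fin a → ℤ) (legal : Legal G f) (K : Subset a)
               (isMax : ∀ x y → x ∈ K → y ∈ N² G K → y ∉ K → f y < f x) where

    g : Fin a → ℤ
    g = merge G v₀ K f

    shift : ℤ
    shift = if does (v₀ ∈? K) then 0ℤ else -1ℤ

    merge-∈ : {e : Fin a} → e ∈ K → g e ≡ f e + shift
    merge-∈ {e} e∈K with v₀ ∈? K | e ∈? K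
    ... | yes _ | yes _   = sym (ℤ.+-identityʳ (f e))
    ... | no _  | yes _   = refl
    ... | _     | no e∉K  = contradiction e∈K e∉K

    merge-∉ : {e : Fin a} → e ∉ K → g e ≡ f e + (shift + 1ℤ)
    merge-∉ {e} e∉K with v₀ ∈? K | e ∈? K
    ... | yes _ | no _    = refl
    ... | no _  | no _    = sym (ℤ.+-identityʳ (f e))
    ... | _     | yes e∈K = contradiction e∈K e∉K

    merge-centered : g v₀ ≡ f v₀
    merge-centered with v₀ ∈? K
    ... | yes _ = refl
    ... | no _  = refl

    boundary-step : {x y : Fin a} {o : Fin b}
      → x ∈ K → y ∉ K → Adj G x o → Adj G y o → f x ≡ f y + 1ℤ
    boundary-step {x} {y} x∈K y∉K ax ay = j<i∧∣j-i∣≤1⇒i≡j+1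
      (isMax x y x∈K (common-neighbour⇒∈N² x∈K ax ay) y∉K)
      (legal y x ((λ { refl → y∉K x∈K }) , _ , ay , ax))

    merge-flat : {x y : Fin a} {o : Fin b} → x ∈ K → y ∉ K → Adj G x o → Adj G y o → g x ≡ g y
    merge-flat {x} {y} x∈K y∉K ax ay = begin
      g x                 ≡⟨ merge-∈ x∈K ⟩
      f x + shift         ≡⟨ cong (_+ shift) (boundary-step x∈K y∉K ax ay) ⟩
      (f y + 1ℤ) + shift  ≡⟨ [i+1]+k≡i+[k+1] (f y) shift ⟩
      f y + (shift + 1ℤ)  ≡⟨ merge-∉ y∉K ⟨
      g y                 ∎
      where open ≡-Reasoning

    legal-under-common-shift : {u v : Fin a} {δ : ℤ} → Dist2 G u v
      → g u ≡ f u + δ → g v ≡ f v + δ → ℤ.∣ g u - g v ∣ ℕ.≤ 1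
    legal-under-common-shift {u} {v} {δ} u~v gu gv = subst (λ d → ℤ.∣ d ∣ ℕ.≤ 1)
      (sym (trans (cong₂ _-_ gu gv) ([i+k]-[j+k]≡i-j (f u) (f v) δ))) (legal u v u~v)

    merge-legal : Legal G g
    merge-legal u v u~v@(_ , _ , au , av) = by-side (u ∈? K) (v ∈? K)
      where
      by-side : Dec (u ∈ K) → Dec (v ∈ K) → ℤ.∣ g u - g v ∣ ℕ.≤ 1
      by-side (yes u∈K) (yes v∈K) = legal-under-common-shift u~v (merge-∈ u∈K) (merge-∈ v∈K)
      by-side (no u∉K)  (no v∉K)  = legal-under-common-shift u~v (merge-∉ u∉K) (merge-∉ v∉K)
      by-side (yes u∈K) (no v∉K)  = i≡j⇒∣i-j∣≤1 (merge-flat u∈K v∉K au av)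
      by-side (no u∉K)  (yes v∈K) = i≡j⇒∣i-j∣≤1 (sym (merge-flat v∈K u∉K av au))

    ∉N─B⇒Monochromatic-merge⇔ : {o : Fin b}
      → o ∉ N G K ─ B G K → Monochromatic f o ⇔ Monochromatic g o
    ∉N─B⇒Monochromatic-merge⇔ {o} o∉N─B with o ∈? B G K
    ... | yes o∈B = Monochromatic-shift shift λ ae → merge-∈ (∈B⇔ .to o∈B _ ae)
    ... | no o∉B  = Monochromatic-shift (shift + 1ℤ) λ ae →
      merge-∉ λ e∈K → o∉N─B (x∈p∧x∉q⇒x∈p─q (∈N⇔ .from (_ , e∈K , ae)) o∉B)

    ∈N─B⇒Monochromatic-merge : {o : Fin b}
      → o ∈ N G K ─ B G K → Monochromatic g o × ¬ Monochromatic f o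
    ∈N─B⇒Monochromatic-merge o∈N─B
      with ∈N⇔ .to (p─q⊆p (N G K) (B G K) o∈N─B) | ∉B⇒∃∉ (x∈p─q⇒x∉q o∈N─B)
    ... | x , x∈K , ax | y , ay , y∉K =
      (λ az az' → trans (g≡gy az) (sym (g≡gy az'))) ,
      (λ mono → ℤ.i≢suc[i]
        (trans (mono ay ax) (trans (boundary-step x∈K y∉K ax ay) (ℤ.+-comm (f y) 1ℤ))))
      where
      g≡gy : ∀ {z} → Adj G z _ → g z ≡ g y
      g≡gy {z} az = by-side (z ∈? K)
        where
        by-side : Dec (z ∈ K) → g z ≡ g y
        by-side (yes z∈K) = merge-flat z∈K y∉K az ay
        by-side (no z∉K)  = trans (sym (merge-flat x∈K z∉K ax az)) (merge-flat x∈K y∉K ax ay)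

    module _ (neighbour : ∀ o → ∃[ e ] Adj G e o) where

      count-monochromatic-merge :
        count (monochromatic? neighbour g)
          ≡ ∣ N G K ─ B G K ∣ ℕ.+ count (monochromatic? neighbour f)
      count-monochromatic-merge = begin
        count (monochromatic? neighbour g)
          ≡⟨ sum-cong-≗ (λ o → indicator-split (o ∈? N G K ─ B G K)
               (monochromatic? neighbour f o) (monochromatic? neighbour g o)
               ∉N─B⇒Monochromatic-merge⇔ ∈N─B⇒Monochromatic-merge) ⟩
        ∑[ o < b ] (indicator (does (o ∈? N G K ─ B G K))
                      ℕ.+ indicator (does (monochromatic? neighbour f o)))
          ≡⟨ ∑-distrib-+ (indicator ∘ does ∘ (_∈? N G K ─ B G K))
                         (indicator ∘ does ∘ monochromatic? neighbour f) ⟩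
        count (_∈? N G K ─ B G K) ℕ.+ count (monochromatic? neighbour f)
          ≡⟨ cong (ℕ._+ count (monochromatic? neighbour f)) (∣p∣≡count∈ (N G K ─ B G K)) ⟨
        ∣ N G K ─ B G K ∣ ℕ.+ count (monochromatic? neighbour f) ∎
        where open ≡-Reasoning

      P-merge : P G g ≡ 2 ^ (∣ N G K ∣ ∸ ∣ B G K ∣) * P G f
      P-merge = begin
        P G g
          ≡⟨ P≡2^count neighbour g ⟩
        2 ^ count (monochromatic? neighbour g)
          ≡⟨ cong (2 ^_) count-monochromatic-merge ⟩
        2 ^ (∣ N G K ─ B G K ∣ ℕ.+ count (monochromatic? neighbour f))
          ≡⟨ ℕ.^-distribˡ-+-* 2 ∣ N G K ─ B G K ∣ (count (monochromatic? neighbour f)) ⟩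
        2 ^ ∣ N G K ─ B G K ∣ * 2 ^ count (monochromatic? neighbour f)
          ≡⟨ cong₂ (λ k m → 2 ^ k * m) (∣p∣∸∣q∣≡∣p─q∣ (B⊆N neighbour)) (P≡2^count neighbour f) ⟨
        2 ^ (∣ N G K ∣ ∸ ∣ B G K ∣) * P G f ∎
        where open ≡-Reasoning

lemma5p3 : ∀ {a b : ℕ} (G : Graph a b) → Connected G → (v₀ : Fin a)
    → (f : Fin a → ℤ) → Legal G f → Centered G v₀ f
    → (K : Subset a) → MaxComponent G f K
    → (Legal G (merge G v₀ K f) × Centered G v₀ (merge G v₀ K f))
      × P G (merge G v₀ K f) ≡ 2 ^ (∣ N G K ∣ ∸ ∣ B G K ∣) * P G f
lemma5p3 G connected v₀ f legal centered K (_ , isMax) =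
  (merge-legal , trans merge-centered centered) , P-merge neighbour
  where
  open Merge G v₀ f legal K isMax
  neighbour : ∀ o → ∃[ e ] Adj G e o
  neighbour o = neighbour-of-reachable G (connected (inj₁ v₀) (inj₂ o))
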